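{- Any data structure that, for a graph on $n$ vertices with positive edge capacities and a designated source vertex $s$ and sink vertex $t$, reports the capacity of the $(s,t)$-mincut after the failure (removal) of any single edge must require $\Omega(n^2\log n)$ bits of space in the worst case, irrespective of its query time. This holds both for undirected and for directed graphs.
   Context: An $(s,t)$-cut is a set $C$ of vertices with $s\in C$, $t\notin C$; its capacity is the total capacity of edges leaving $C$ (for undirected graphs: edges with exactly one endpoint in $C$); the $(s,t)$-mincut capacity is the minimum capacity of an $(s,t)$-cut. -}

module Defs where

open import Data.Nat using (ℕ; zero; suc; _+_; _*_; _^_; _≤_; _<_)
open import Data.Nat.Logarithm using (⌊log₂_⌋)
open import Data.Bool using (Bool; true; false; _∧_; not; if_then_else_)
open import Data.Fin using (Fin; _≟_)
open import Data.List using (List; map; allFin; length)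
open import Data.Nat.ListAction using (sum)
open import Data.Product using (Σ; ∃; ∃-syntax; _×_; _,_)
open import Relation.Nullary using (¬_; yes; no)
open import Relation.Binary.PropositionalEquality using (_≡_; _≢_)

-- A (capacitated) graph on vertex set Fin n: cap u v = capacity of the
-- edge u → v; cap u v ≡ 0 means "no edge", so all edges have positive capacity.
Cap : ℕ → Set
Cap n = Fin n → Fin n → ℕ

data Kind : Set where
  directed undirected : Kind

-- Valid graphs of the given kind whose capacities are at most B:
-- no self-loops; undirected graphs have symmetric capacity matrices
-- (cap u v = cap v u = capacity of the undirected edge {u,v}).
Valid : Kind → {n : ℕ} → ℕ → Cap n → Set
Valid directed   B cap = (∀ u → cap u u ≡ 0) × (∀ u v → cap u v ≤ B)
Valid undirected B cap =
  (∀ u → cap u u ≡ 0) × (∀ u v → cap u v ≤ B) × (∀ u v → cap u v ≡ cap v u)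

removeEdge : Kind → {n : ℕ} → Cap n → Fin n → Fin n → Cap n
removeEdge directed cap u v x y with x ≟ u | y ≟ v
... | yes _ | yes _ = 0
... | _     | _     = cap x y
removeEdge undirected cap u v x y with x ≟ u | y ≟ v | x ≟ v | y ≟ u
... | yes _ | yes _ | _     | _     = 0
... | _     | _     | yes _ | yes _ = 0
... | _     | _     | _     | _     = cap x y

-- Capacity: total capacity of edges leaving C (for a symmetric matrix this
-- is exactly the total capacity of edges with exactly one endpoint in C).
cutCapacity : {n : ℕ} → Cap n → (Fin n → Bool) → ℕ
cutCapacity {n} cap C =
  sum (map (λ u → sum (map (λ v → if C u ∧ not (C v) then cap u v else 0)
                           (allFin n)))
           (allFin n))

IsSTCut : {n : ℕ} → (Fin n → Bool) → Fin n → Fin n → Set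
IsSTCut C s t = (C s ≡ true) × (C t ≡ false)

IsMinCutValue : {n : ℕ} → Cap n → Fin n → Fin n → ℕ → Set
IsMinCutValue cap s t m =
  (∃[ C ] (IsSTCut C s t × cutCapacity cap C ≡ m)) ×
  (∀ C → IsSTCut C s t → m ≤ cutCapacity cap C)

-- A data structure (of arbitrary query time): a preprocessing map producing
-- a bit string from the input (G, s, t), and an arbitrary query function
-- working only from that bit string.
record Oracle (n : ℕ) : Set where
  field
    encode : Cap n → Fin n → Fin n → List Bool
    query  : List Bool → Fin n → Fin n → ℕ
open Oracle public

Correct : Kind → {n : ℕ} → ℕ → Oracle n → Set
Correct kind {n} B O =
  ∀ (cap : Cap n) (s t : Fin n) → Valid kind B cap → s ≢ t →
  ∀ u v → 0 < cap u v →
  IsMinCutValue (removeEdge kind cap u v) s t (query O (encode O cap s t) u v)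

SpaceLowerBound : Kind → Set
SpaceLowerBound kind =
  ∃[ k ] ∃[ d ] ∃[ n₀ ] ∀ n → n₀ ≤ n → (O : Oracle n) → Correct kind (n ^ k) O →
  ∃[ cap ] ∃[ s ] ∃[ t ]
    (Valid kind (n ^ k) cap × s ≢ t ×
     n * n * ⌊log₂ n ⌋ ≤ d * length (encode O cap s t))

-- Split the n - 2 inner vertices into h left vertices aᵢ and m ≈ h right vertices bⱼ, and
-- join the source to every aᵢ and every bⱼ to the sink by an edge of capacity n⁴, each aᵢ
-- to each bⱼ by an edge of arbitrary weight wᵢⱼ ∈ [1, 2 ^ ⌊log₂ n⌋], and distinct aᵢ by unit
-- edges. The cut {s} ∪ {aᵢ} has capacity W = Σ wᵢⱼ < n⁴, while every other (s,t)-cut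
-- contains an edge of capacity n⁴; so it remains the minimum cut after the failure of any
-- edge between inner vertices. The oracle therefore answers W - wᵢⱼ for the edge aᵢbⱼ and W
-- for a unit edge, i.e. its bit string determines all h · m ≈ n² / 4 weights, and by
-- counting some choice of weights needs ⌊log₂ n⌋ · h · m bits.
module Submission where

open import Defs
open import Data.Bool using (Bool; true; false; _∧_; not; if_then_else_)
import Data.Bool.Properties as Bool
open import Data.Empty using (⊥-elim)
open import Data.Fin
  using (Fin; zero; suc; toℕ; fromℕ<; punchIn; _≟_; splitAt; _↑ˡ_; _↑ʳ_; combine; remQuot; finToFun; funToFin)
open import Data.Fin.Properties
  using (punchInᵢ≢i; any?; all?; ¬∀⟶∃¬; fromℕ<-injective; injective⇒≤; splitAt-↑ˡ; splitAt-↑ʳ;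
         toℕ<n; toℕ-injective; combine-remQuot; funToFin-finToFin)
open import Data.List using (List; []; _∷_; length; map; allFin; tabulate)
open import Data.List.Properties using (map-tabulate)
open import Data.Nat
  using (ℕ; zero; suc; pred; _+_; _*_; _^_; _≤_; _≰_; _<_; z≤n; s≤s; z<s; _≤?_; ⌊_/2⌋; ⌈_/2⌉)
open import Data.Nat.Binary using (ℕᵇ; zero; 2[1+_]; 1+[2_]; size) renaming (toℕ to toℕᵇ)
import Data.Nat.Binary.Properties as ℕᵇ
open import Data.Nat.Induction using (<-wellFounded)
open import Data.Nat.ListAction using (sum)
open import Data.Nat.Logarithm using (⌊log₂_⌋)
open import Data.Nat.Logarithm.Core using (⌊log2⌋)
open import Data.Nat.Properties hiding (_≟_)
open import Data.Nat.Tactic.RingSolver using (solve-∀)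
open import Data.Product using (∃-syntax; _×_; _,_; uncurry)
open import Data.Sum using (inj₁; inj₂; [_,_])
open import Function using (_∘_; id)
open import Function.Definitions using (Injective)
open import Induction.WellFounded using (Acc; acc)
open import Relation.Nullary using (¬_; yes; no; contradiction)
open import Relation.Binary.PropositionalEquality
  using (_≡_; _≢_; refl; sym; trans; cong; cong₂; subst; module ≡-Reasoning)

open import Algebra.Properties.CommutativeMonoid.Sum +-0-commutativeMonoid
  using (sum-cong-≗; sum-remove) renaming (sum to ∑)

private
  variable
    n : ℕ

sum-map-allFin : ∀ n (f : Fin n → ℕ) → sum (map f (allFin n)) ≡ ∑ f
sum-map-allFin n f = trans (cong sum (map-tabulate id f)) (sum-tabulate n f)
  where
  sum-tabulate : ∀ n (f : Fin n → ℕ) → sum (tabulate f) ≡ ∑ f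
  sum-tabulate zero    f = refl
  sum-tabulate (suc n) f = cong (f zero +_) (sum-tabulate n (f ∘ suc))

∑-mono-≤ : {f g : Fin n → ℕ} → (∀ i → f i ≤ g i) → ∑ f ≤ ∑ g
∑-mono-≤ {zero}  f≤g = z≤n
∑-mono-≤ {suc n} f≤g = +-mono-≤ (f≤g zero) (∑-mono-≤ (f≤g ∘ suc))

∑-bounded : {f : Fin n → ℕ} {c : ℕ} → (∀ i → f i ≤ c) → ∑ f ≤ n * c
∑-bounded {zero}  f≤c = z≤n
∑-bounded {suc n} f≤c = +-mono-≤ (f≤c zero) (∑-bounded (f≤c ∘ suc))

f[i]≤∑f : ∀ (f : Fin n → ℕ) i → f i ≤ ∑ f
f[i]≤∑f {suc n} f i = ≤-trans (m≤m+n (f i) _) (≤-reflexive (sym (sum-remove {i = i} f)))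

∑-update : ∀ (f g : Fin n → ℕ) i d → (∀ j → j ≢ i → g j ≡ f j) → g i + d ≡ f i →
           ∑ g + d ≡ ∑ f
∑-update {suc n} f g i d g≡f gi+d≡fi = begin
  ∑ g + d                                  ≡⟨ cong (_+ d) (sum-remove {i = i} g) ⟩
  g i + ∑ (g ∘ punchIn i) + d              ≡⟨ +-assoc (g i) _ d ⟩
  g i + (∑ (g ∘ punchIn i) + d)            ≡⟨ cong (g i +_) (+-comm _ d) ⟩
  g i + (d + ∑ (g ∘ punchIn i))            ≡⟨ +-assoc (g i) d _ ⟨
  g i + d + ∑ (g ∘ punchIn i)              ≡⟨ cong₂ _+_ gi+d≡fi (sum-cong-≗ (λ j → g≡f _ (punchInᵢ≢i i j))) ⟩
  f i + ∑ (f ∘ punchIn i)                  ≡⟨ sum-remove {i = i} f ⟨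
  ∑ f                                      ∎
  where open ≡-Reasoning

crossing : Cap n → (Fin n → Bool) → Fin n → Fin n → ℕ
crossing cap C u v = if C u ∧ not (C v) then cap u v else 0

cutCapacity≡∑∑crossing : (cap : Cap n) (C : Fin n → Bool) →
                         cutCapacity cap C ≡ ∑ (λ u → ∑ (λ v → crossing cap C u v))
cutCapacity≡∑∑crossing {n} cap C =
  trans (sum-map-allFin n _) (sum-cong-≗ (λ u → sum-map-allFin n (crossing cap C u)))

module _ (cap : Cap n) (C : Fin n → Bool) (u v : Fin n) where

  crossing-across : C u ≡ true → C v ≡ false → crossing cap C u v ≡ cap u v
  crossing-across Cu Cv rewrite Cu | Cv = refl

  crossing-bounded : ∀ {c} → (C u ≡ true → C v ≡ false → cap u v ≤ c) → crossing cap C u v ≤ c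
  crossing-bounded bound with C u | C v
  ... | true  | false = bound refl refl
  ... | true  | true  = z≤n
  ... | false | _     = z≤n

  crossing-monoˡ : (cap′ : Cap n) → cap u v ≤ cap′ u v → crossing cap C u v ≤ crossing cap′ C u v
  crossing-monoˡ cap′ cap≤cap′ with C u | C v
  ... | true  | false = cap≤cap′
  ... | true  | true  = z≤n
  ... | false | _     = z≤n

  crossing-cong : (cap′ : Cap n) → (C u ≡ true → C v ≡ false → cap u v ≡ cap′ u v) →
                  crossing cap C u v ≡ crossing cap′ C u v
  crossing-cong cap′ eq with C u | C v
  ... | true  | false = eq refl refl
  ... | true  | true  = refl
  ... | false | _     = refl

cutCapacity-congʳ : (cap : Cap n) {C D : Fin n → Bool} → (∀ x → C x ≡ D x) →
                    cutCapacity cap C ≡ cutCapacity cap D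
cutCapacity-congʳ cap {C} {D} C≗D = begin
  cutCapacity cap C                                ≡⟨ cutCapacity≡∑∑crossing cap C ⟩
  ∑ (λ u → ∑ (λ v → crossing cap C u v))           ≡⟨ sum-cong-≗ (λ u → sum-cong-≗ (entry u)) ⟩
  ∑ (λ u → ∑ (λ v → crossing cap D u v))           ≡⟨ cutCapacity≡∑∑crossing cap D ⟨
  cutCapacity cap D                                ∎
  where
  open ≡-Reasoning
  entry : ∀ u v → crossing cap C u v ≡ crossing cap D u v
  entry u v = cong₂ (λ a b → if a ∧ not b then cap u v else 0) (C≗D u) (C≗D v)

cutCapacity-monoˡ : {cap cap′ : Cap n} → (∀ u v → cap u v ≤ cap′ u v) → (C : Fin n → Bool) →
                    cutCapacity cap C ≤ cutCapacity cap′ C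
cutCapacity-monoˡ {cap = cap} {cap′} cap≤cap′ C = begin
  cutCapacity cap C                                ≡⟨ cutCapacity≡∑∑crossing cap C ⟩
  ∑ (λ u → ∑ (λ v → crossing cap C u v))
    ≤⟨ ∑-mono-≤ (λ u → ∑-mono-≤ (λ v → crossing-monoˡ cap C u v cap′ (cap≤cap′ u v))) ⟩
  ∑ (λ u → ∑ (λ v → crossing cap′ C u v))          ≡⟨ cutCapacity≡∑∑crossing cap′ C ⟨
  cutCapacity cap′ C                               ∎
  where open ≤-Reasoning

crossingEdge≤cutCapacity : (cap : Cap n) (C : Fin n → Bool) (u v : Fin n) →
                           C u ≡ true → C v ≡ false → cap u v ≤ cutCapacity cap C
crossingEdge≤cutCapacity cap C u v Cu Cv = begin
  cap u v                                          ≡⟨ crossing-across cap C u v Cu Cv ⟨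
  crossing cap C u v                               ≤⟨ f[i]≤∑f (crossing cap C u) v ⟩
  ∑ (crossing cap C u)                             ≤⟨ f[i]≤∑f (λ u → ∑ (crossing cap C u)) u ⟩
  ∑ (λ u → ∑ (λ v → crossing cap C u v))           ≡⟨ cutCapacity≡∑∑crossing cap C ⟨
  cutCapacity cap C                                ∎
  where open ≤-Reasoning

cutCapacity-bounded : (cap : Cap n) (C : Fin n → Bool) {c : ℕ} →
                      (∀ u v → C u ≡ true → C v ≡ false → cap u v ≤ c) →
                      cutCapacity cap C ≤ n * (n * c)
cutCapacity-bounded cap C bound = ≤-trans (≤-reflexive (cutCapacity≡∑∑crossing cap C))
  (∑-bounded (λ u → ∑-bounded (λ v → crossing-bounded cap C u v (bound u v))))

module _ (cap : Cap n) (u v : Fin n) where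

  removeEdge-removed : ∀ kind → removeEdge kind cap u v u v ≡ 0
  removeEdge-removed directed with u ≟ u | v ≟ v
  ... | yes _  | yes _  = refl
  ... | no u≢u | _      = ⊥-elim (u≢u refl)
  ... | yes _  | no v≢v = ⊥-elim (v≢v refl)
  removeEdge-removed undirected with u ≟ u | v ≟ v
  ... | yes _  | yes _  = refl
  ... | no u≢u | _      = ⊥-elim (u≢u refl)
  ... | yes _  | no v≢v = ⊥-elim (v≢v refl)

  removeEdge-elsewhere : ∀ kind {x y} → ¬ (x ≡ u × y ≡ v) → ¬ (x ≡ v × y ≡ u) →
                         removeEdge kind cap u v x y ≡ cap x y
  removeEdge-elsewhere directed {x} {y} ≢uv ≢vu with x ≟ u | y ≟ v
  ... | yes x≡u | yes y≡v = ⊥-elim (≢uv (x≡u , y≡v))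
  ... | yes _   | no _    = refl
  ... | no _    | _       = refl
  removeEdge-elsewhere undirected {x} {y} ≢uv ≢vu with x ≟ u | y ≟ v | x ≟ v | y ≟ u
  ... | yes x≡u | yes y≡v | _       | _       = ⊥-elim (≢uv (x≡u , y≡v))
  ... | yes _   | no _    | yes x≡v | yes y≡u = ⊥-elim (≢vu (x≡v , y≡u))
  ... | yes _   | no _    | yes _   | no _    = refl
  ... | yes _   | no _    | no _    | _       = refl
  ... | no _    | _       | yes x≡v | yes y≡u = ⊥-elim (≢vu (x≡v , y≡u))
  ... | no _    | _       | yes _   | no _    = refl
  ... | no _    | _       | no _    | _       = refl

  removeEdge-≤ : ∀ kind x y → removeEdge kind cap u v x y ≤ cap x y
  removeEdge-≤ directed x y with x ≟ u | y ≟ v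
  ... | yes _ | yes _ = z≤n
  ... | yes _ | no _  = ≤-refl
  ... | no _  | _     = ≤-refl
  removeEdge-≤ undirected x y with x ≟ u | y ≟ v | x ≟ v | y ≟ u
  ... | yes _ | yes _ | _     | _     = z≤n
  ... | yes _ | no _  | yes _ | yes _ = z≤n
  ... | yes _ | no _  | yes _ | no _  = ≤-refl
  ... | yes _ | no _  | no _  | _     = ≤-refl
  ... | no _  | _     | yes _ | yes _ = z≤n
  ... | no _  | _     | yes _ | no _  = ≤-refl
  ... | no _  | _     | no _  | _     = ≤-refl

  module _ (kind : Kind) (C : Fin n → Bool) (Cu : C u ≡ true) where

    private
      cap′ : Cap n
      cap′ = removeEdge kind cap u v

      separated : ∀ {x y} → C x ≡ true → C y ≡ false → x ≢ y
      separated Cx Cy refl = Bool.not-¬ Cx Cy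

    cutCapacity-removeEdge-inside : C v ≡ true →
                                    cutCapacity (removeEdge kind cap u v) C ≡ cutCapacity cap C
    cutCapacity-removeEdge-inside Cv = begin
      cutCapacity cap′ C               ≡⟨ cutCapacity≡∑∑crossing cap′ C ⟩
      ∑ (λ x → ∑ (crossing cap′ C x))  ≡⟨ sum-cong-≗ (λ x → sum-cong-≗ (λ y → crossing-cong cap′ C x y cap untouched)) ⟩
      ∑ (λ x → ∑ (crossing cap C x))   ≡⟨ cutCapacity≡∑∑crossing cap C ⟨
      cutCapacity cap C                ∎
      where
      open ≡-Reasoning
      untouched : ∀ {x y} → C x ≡ true → C y ≡ false → cap′ x y ≡ cap x y
      untouched Cx Cy = removeEdge-elsewhere kind (λ (_ , y≡v) → separated Cv Cy (sym y≡v))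
                                                  (λ (_ , y≡u) → separated Cu Cy (sym y≡u))

    cutCapacity-removeEdge-across : C v ≡ false →
                                    cutCapacity (removeEdge kind cap u v) C + cap u v ≡ cutCapacity cap C
    cutCapacity-removeEdge-across Cv = begin
      cutCapacity cap′ C + cap u v               ≡⟨ cong (_+ cap u v) (cutCapacity≡∑∑crossing cap′ C) ⟩
      ∑ (λ x → ∑ (crossing cap′ C x)) + cap u v  ≡⟨ ∑-update _ _ u (cap u v) other-rows row-u ⟩
      ∑ (λ x → ∑ (crossing cap C x))             ≡⟨ cutCapacity≡∑∑crossing cap C ⟨
      cutCapacity cap C                          ∎
      where
      open ≡-Reasoning
      untouched : ∀ {x y} → ¬ (x ≡ u × y ≡ v) → C x ≡ true → C y ≡ false → cap′ x y ≡ cap x y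
      untouched ≢uv Cx Cy = removeEdge-elsewhere kind ≢uv (λ (x≡v , _) → separated Cx Cv x≡v)
      other-rows : ∀ x → x ≢ u → ∑ (crossing cap′ C x) ≡ ∑ (crossing cap C x)
      other-rows x x≢u =
        sum-cong-≗ (λ y → crossing-cong cap′ C x y cap (untouched (λ (x≡u , _) → x≢u x≡u)))
      row-u : ∑ (crossing cap′ C u) + cap u v ≡ ∑ (crossing cap C u)
      row-u = ∑-update _ _ v (cap u v)
        (λ y y≢v → crossing-cong cap′ C u y cap (untouched (λ (_ , y≡v) → y≢v y≡v)))
        (begin
          crossing cap′ C u v + cap u v  ≡⟨ cong (_+ cap u v) (crossing-across cap′ C u v Cu Cv) ⟩
          cap′ u v + cap u v             ≡⟨ cong (_+ cap u v) (removeEdge-removed kind) ⟩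
          cap u v                        ≡⟨ crossing-across cap C u v Cu Cv ⟨
          crossing cap C u v             ∎)

minCutValue-unique : {cap : Cap n} {s t : Fin n} {p q : ℕ} →
                     IsMinCutValue cap s t p → IsMinCutValue cap s t q → p ≡ q
minCutValue-unique ((Cp , st-p , refl) , p-min) ((Cq , st-q , refl) , q-min) =
  ≤-antisym (p-min Cq st-q) (q-min Cp st-p)

fromBits : List Bool → ℕᵇ
fromBits []           = zero
fromBits (false ∷ bs) = 1+[2 fromBits bs ]
fromBits (true  ∷ bs) = 2[1+ fromBits bs ]

toBits : ℕᵇ → List Bool
toBits zero     = []
toBits 1+[2 x ] = false ∷ toBits x
toBits 2[1+ x ] = true ∷ toBits x

toBits-fromBits : ∀ bs → toBits (fromBits bs) ≡ bs
toBits-fromBits []           = refl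
toBits-fromBits (false ∷ bs) = cong (false ∷_) (toBits-fromBits bs)
toBits-fromBits (true  ∷ bs) = cong (true ∷_) (toBits-fromBits bs)

fromBits-injective : Injective _≡_ _≡_ fromBits
fromBits-injective {bs} {bs′} eq =
  trans (sym (toBits-fromBits bs)) (trans (cong toBits eq) (toBits-fromBits bs′))

size-fromBits : ∀ bs → size (fromBits bs) ≡ length bs
size-fromBits []           = refl
size-fromBits (false ∷ bs) = cong suc (size-fromBits bs)
size-fromBits (true  ∷ bs) = cong suc (size-fromBits bs)

-- The 2 ^ (s + 1) - 1 numerals with at most s digits denote 0, 1, …, 2 ^ (s + 1) - 2.
2+toℕᵇ≤2^[1+size] : ∀ x → 2 + toℕᵇ x ≤ 2 ^ suc (size x)
2+toℕᵇ≤2^[1+size] zero     = ≤-refl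
2+toℕᵇ≤2^[1+size] 2[1+ x ] = begin
  2 + 2 * suc (toℕᵇ x)  ≡⟨ *-distribˡ-+ 2 1 (suc (toℕᵇ x)) ⟨
  2 * (2 + toℕᵇ x)      ≤⟨ *-monoʳ-≤ 2 (2+toℕᵇ≤2^[1+size] x) ⟩
  2 * 2 ^ suc (size x)  ∎
  where open ≤-Reasoning
2+toℕᵇ≤2^[1+size] 1+[2 x ] = begin
  3 + 2 * toℕᵇ x        ≤⟨ n≤1+n _ ⟩
  4 + 2 * toℕᵇ x        ≡⟨ *-distribˡ-+ 2 2 (toℕᵇ x) ⟨
  2 * (2 + toℕᵇ x)      ≤⟨ *-monoʳ-≤ 2 (2+toℕᵇ≤2^[1+size] x) ⟩
  2 * 2 ^ suc (size x)  ∎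
  where open ≤-Reasoning

-- Fewer than 2 ^ L bit strings are shorter than L.
long-codeword : ∀ {N} L → 2 ^ L ≤ N → (enc : Fin N → List Bool) → Injective _≡_ _≡_ enc →
                ∃[ i ] L ≤ length (enc i)
long-codeword {N} L 2^L≤N enc enc-injective with any? (λ i → L ≤? length (enc i))
... | yes long = long
... | no ¬long = contradiction (≤-trans 2^L≤N (injective⇒≤ code-injective)) 2^L≰pred[2^L]
  where
  code< : ∀ i → toℕᵇ (fromBits (enc i)) < pred (2 ^ L)
  code< i = pred-mono-≤ (begin
    2 + toℕᵇ (fromBits (enc i))           ≤⟨ 2+toℕᵇ≤2^[1+size] (fromBits (enc i)) ⟩
    2 ^ suc (size (fromBits (enc i)))     ≡⟨ cong (λ s → 2 ^ suc s) (size-fromBits (enc i)) ⟩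
    2 ^ suc (length (enc i))              ≤⟨ ^-monoʳ-≤ 2 (≰⇒> (λ long → ¬long (i , long))) ⟩
    2 ^ L                                 ∎)
    where open ≤-Reasoning
  code : Fin N → Fin (pred (2 ^ L))
  code i = fromℕ< (code< i)
  code-injective : Injective _≡_ _≡_ code
  code-injective {i} {j} = enc-injective ∘ fromBits-injective ∘ ℕᵇ.toℕ-injective
                         ∘ fromℕ<-injective _ _ (code< i) (code< j)
  2^L≰pred[2^L] : 2 ^ L ≰ pred (2 ^ L)
  2^L≰pred[2^L] le = 1+n≰n (subst (_≤ pred (2 ^ L)) (sym (suc-pred (2 ^ L) {{m^n≢0 2 L}})) le)

2*⌊n/2⌋≤n : ∀ n → 2 * ⌊ n /2⌋ ≤ n
2*⌊n/2⌋≤n n = begin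
  2 * ⌊ n /2⌋         ≡⟨ cong (⌊ n /2⌋ +_) (+-identityʳ ⌊ n /2⌋) ⟩
  ⌊ n /2⌋ + ⌊ n /2⌋   ≤⟨ +-monoʳ-≤ ⌊ n /2⌋ (⌊n/2⌋≤⌈n/2⌉ n) ⟩
  ⌊ n /2⌋ + ⌈ n /2⌉   ≡⟨ ⌊n/2⌋+⌈n/2⌉≡n n ⟩
  n                   ∎
  where open ≤-Reasoning

6+n≤4*⌊[4+n]/2⌋ : ∀ n → 6 + n ≤ 4 * ⌊ 4 + n /2⌋
6+n≤4*⌊[4+n]/2⌋ 0             = m≤m+n 6 2
6+n≤4*⌊[4+n]/2⌋ 1             = n≤1+n 7
6+n≤4*⌊[4+n]/2⌋ (suc (suc n)) = begin
  2 + (6 + n)              ≤⟨ +-monoʳ-≤ 2 (6+n≤4*⌊[4+n]/2⌋ n) ⟩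
  2 + 4 * ⌊ 4 + n /2⌋      ≤⟨ +-monoˡ-≤ (4 * ⌊ 4 + n /2⌋) (m≤m+n 2 2) ⟩
  4 + 4 * ⌊ 4 + n /2⌋      ≡⟨ *-suc 4 ⌊ 4 + n /2⌋ ⟨
  4 * ⌊ 6 + n /2⌋          ∎
  where open ≤-Reasoning

2^⌊log₂n⌋≤n : ∀ {n} → 0 < n → 2 ^ ⌊log₂ n ⌋ ≤ n
2^⌊log₂n⌋≤n {suc n} _ = 2^⌊log2⌋≤ n (<-wellFounded (suc n))
  where
  2^⌊log2⌋≤ : ∀ n (rec : Acc _<_ (suc n)) → 2 ^ ⌊log2⌋ (suc n) rec ≤ suc n
  2^⌊log2⌋≤ zero    _        = ≤-refl
  2^⌊log2⌋≤ (suc n) (acc rs) = begin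
    2 * 2 ^ ⌊log2⌋ (suc ⌊ n /2⌋) _   ≤⟨ *-monoʳ-≤ 2 (2^⌊log2⌋≤ ⌊ n /2⌋ _) ⟩
    2 * suc ⌊ n /2⌋                   ≡⟨ *-suc 2 ⌊ n /2⌋ ⟩
    2 + 2 * ⌊ n /2⌋                   ≤⟨ +-monoʳ-≤ 2 (2*⌊n/2⌋≤n n) ⟩
    2 + n                             ∎
    where open ≤-Reasoning

n²ℓ≤16ℓhm : ∀ {n h m} ℓ → n ≤ 4 * h → h ≤ m → n * n * ℓ ≤ 16 * (ℓ * (h * m))
n²ℓ≤16ℓhm {n} {h} {m} ℓ n≤4h h≤m = begin
  n * n * ℓ                 ≤⟨ *-monoˡ-≤ ℓ (*-mono-≤ n≤4h (≤-trans n≤4h (*-monoʳ-≤ 4 h≤m))) ⟩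
  4 * h * (4 * m) * ℓ       ≡⟨ rearrange h m ℓ ⟩
  16 * (ℓ * (h * m))        ∎
  where
  open ≤-Reasoning
  rearrange : ∀ h m ℓ → 4 * h * (4 * m) * ℓ ≡ 16 * (ℓ * (h * m))
  rearrange = solve-∀

funToFin-cong : ∀ {k l} {f g : Fin k → Fin l} → (∀ p → f p ≡ g p) → funToFin f ≡ funToFin g
funToFin-cong {zero}  _   = refl
funToFin-cong {suc k} f≗g = cong₂ combine (f≗g zero) (funToFin-cong (f≗g ∘ suc))

finToFun-injective : ∀ {k l} {c c′ : Fin (l ^ k)} →
                     (∀ p → finToFun {l} {k} c p ≡ finToFun c′ p) → c ≡ c′
finToFun-injective {k} {l} {c} {c′} same = begin
  c                                ≡⟨ funToFin-finToFin {k} {l} c ⟨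
  funToFin (finToFun {l} {k} c)    ≡⟨ funToFin-cong same ⟩
  funToFin (finToFun {l} {k} c′)   ≡⟨ funToFin-finToFin {k} {l} c′ ⟩
  c′                               ∎
  where open ≡-Reasoning

data Vertex (h m : ℕ) : Set where
  source sink : Vertex h m
  left        : Fin h → Vertex h m
  right       : Fin m → Vertex h m

module Layout (h m : ℕ) where

  vertex : Fin (2 + (h + m)) → Vertex h m
  vertex zero          = source
  vertex (suc zero)    = sink
  vertex (suc (suc x)) = [ left , right ] (splitAt h x)

  leftVertex : Fin h → Fin (2 + (h + m))
  leftVertex i = suc (suc (i ↑ˡ m))

  rightVertex : Fin m → Fin (2 + (h + m))
  rightVertex j = suc (suc (h ↑ʳ j))

  vertex-leftVertex : ∀ i → vertex (leftVertex i) ≡ left i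
  vertex-leftVertex i = cong [ left , right ] (splitAt-↑ˡ h i m)

  vertex-rightVertex : ∀ j → vertex (rightVertex j) ≡ right j
  vertex-rightVertex j = cong [ left , right ] (splitAt-↑ʳ h m j)

module Gadget {h m : ℕ} (H : ℕ) (w : Fin h → Fin m → ℕ) where

  open Layout h m

  unitIfDistinct : Fin h → Fin h → ℕ
  unitIfDistinct i i′ with i ≟ i′
  ... | yes _ = 0
  ... | no _  = 1

  link : Vertex h m → Vertex h m → ℕ
  link source    (left _)   = H
  link (left _)  source     = H
  link (right _) sink       = H
  link sink      (right _)  = H
  link (left i)  (right j)  = w i j
  link (right j) (left i)   = w i j
  link (left i)  (left i′)  = unitIfDistinct i i′
  link _         _          = 0

  onSourceSide : Vertex h m → Bool
  onSourceSide source    = true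
  onSourceSide sink      = false
  onSourceSide (left _)  = true
  onSourceSide (right _) = false

  capacity : Cap (2 + (h + m))
  capacity x y = link (vertex x) (vertex y)

  sourceSide : Fin (2 + (h + m)) → Bool
  sourceSide x = onSourceSide (vertex x)

  link-irreflexive : ∀ a → link a a ≡ 0
  link-irreflexive source    = refl
  link-irreflexive sink      = refl
  link-irreflexive (right _) = refl
  link-irreflexive (left i) with i ≟ i
  ... | yes _   = refl
  ... | no i≢i  = ⊥-elim (i≢i refl)

  link-sym : ∀ a b → link a b ≡ link b a
  link-sym source    (left _)   = refl
  link-sym (left _)  source     = refl
  link-sym (right _) sink       = refl
  link-sym sink      (right _)  = refl
  link-sym (left _)  (right _)  = refl
  link-sym (right _) (left _)   = refl
  link-sym (left i)  (left i′)  with i ≟ i′ | i′ ≟ i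
  ... | yes _    | yes _    = refl
  ... | no _     | no _     = refl
  ... | yes i≡i′ | no i′≢i  = ⊥-elim (i′≢i (sym i≡i′))
  ... | no i≢i′  | yes i′≡i = ⊥-elim (i≢i′ (sym i′≡i))
  link-sym source    source     = refl
  link-sym source    sink       = refl
  link-sym source    (right _)  = refl
  link-sym sink      source     = refl
  link-sym sink      sink       = refl
  link-sym sink      (left _)   = refl
  link-sym (left _)  sink       = refl
  link-sym (right _) source     = refl
  link-sym (right _) (right _)  = refl

  capacity-irreflexive : ∀ x → capacity x x ≡ 0
  capacity-irreflexive x = link-irreflexive (vertex x)

  capacity-sym : ∀ x y → capacity x y ≡ capacity y x
  capacity-sym x y = link-sym (vertex x) (vertex y)

  module _ (w≤H : ∀ i j → w i j ≤ H) (1≤H : 1 ≤ H) where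

    link-bounded : ∀ a b → link a b ≤ H
    link-bounded source    (left _)  = ≤-refl
    link-bounded (left _)  source    = ≤-refl
    link-bounded (right _) sink      = ≤-refl
    link-bounded sink      (right _) = ≤-refl
    link-bounded (left i)  (right j) = w≤H i j
    link-bounded (right j) (left i)  = w≤H i j
    link-bounded (left i)  (left i′) with i ≟ i′
    ... | yes _ = z≤n
    ... | no _  = 1≤H
    link-bounded source    source    = z≤n
    link-bounded source    sink      = z≤n
    link-bounded source    (right _) = z≤n
    link-bounded sink      source    = z≤n
    link-bounded sink      sink      = z≤n
    link-bounded sink      (left _)  = z≤n
    link-bounded (left _)  sink      = z≤n
    link-bounded (right _) source    = z≤n
    link-bounded (right _) (right _) = z≤n

    capacity-bounded : ∀ x y → capacity x y ≤ H
    capacity-bounded x y = link-bounded (vertex x) (vertex y)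

    capacity-valid : ∀ kind → Valid kind H capacity
    capacity-valid directed   = capacity-irreflexive , capacity-bounded
    capacity-valid undirected = capacity-irreflexive , capacity-bounded , capacity-sym

  sourceSide-cut≤ : ∀ {c} → (∀ i j → w i j ≤ c) →
                    cutCapacity capacity sourceSide ≤ (2 + (h + m)) * ((2 + (h + m)) * c)
  sourceSide-cut≤ w≤c = cutCapacity-bounded capacity sourceSide
    (λ x y → across (vertex x) (vertex y))
    where
    across : ∀ a b → onSourceSide a ≡ true → onSourceSide b ≡ false → link a b ≤ _
    across source   sink      _ _ = z≤n
    across source   (right _) _ _ = z≤n
    across (left _) sink      _ _ = z≤n
    across (left i) (right j) _ _ = w≤c i j

  module _ (kind : Kind) (u v : Fin (h + m)) where

    afterFailure : Cap (2 + (h + m))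
    afterFailure = removeEdge kind capacity (suc (suc u)) (suc (suc v))

    otherCut-heavy : ∀ C → IsSTCut C zero (suc zero) → ∀ x → C x ≢ sourceSide x →
                     H ≤ cutCapacity afterFailure C
    otherCut-heavy C (Cs , _)  zero       Cx≢ = ⊥-elim (Cx≢ Cs)
    otherCut-heavy C (_ , Ct)  (suc zero) Cx≢ = ⊥-elim (Cx≢ Ct)
    otherCut-heavy C (Cs , Ct) (suc (suc y)) Cx≢ with splitAt h y in eq
    ... | inj₁ i = subst (_≤ cutCapacity afterFailure C) source→left
                     (crossingEdge≤cutCapacity afterFailure C zero (suc (suc y)) Cs (Bool.¬-not Cx≢))
      where
      source→left : afterFailure zero (suc (suc y)) ≡ H
      source→left = trans (removeEdge-elsewhere capacity _ _ kind (λ ()) (λ ()))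
                          (cong (link source ∘ [ left , right ]) eq)
    ... | inj₂ j = subst (_≤ cutCapacity afterFailure C) right→sink
                     (crossingEdge≤cutCapacity afterFailure C (suc (suc y)) (suc zero) (Bool.¬-not Cx≢) Ct)
      where
      right→sink : afterFailure (suc (suc y)) (suc zero) ≡ H
      right→sink = trans (removeEdge-elsewhere capacity _ _ kind (λ ()) (λ ()))
                         (cong (λ a → link ([ left , right ] a) sink) eq)

    sourceSide-minCut : cutCapacity capacity sourceSide < H →
                        IsMinCutValue afterFailure zero (suc zero) (cutCapacity afterFailure sourceSide)
    sourceSide-minCut light = (sourceSide , (refl , refl) , refl) , minimal
      where
      minimal : ∀ C → IsSTCut C zero (suc zero) →
                cutCapacity afterFailure sourceSide ≤ cutCapacity afterFailure C
      minimal C st with all? (λ x → C x Bool.≟ sourceSide x)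
      ... | yes C≗sourceSide = ≤-reflexive (cutCapacity-congʳ afterFailure (sym ∘ C≗sourceSide))
      ... | no C≉sourceSide  =
        let x , Cx≢ = ¬∀⟶∃¬ _ _ (λ x → C x Bool.≟ sourceSide x) C≉sourceSide in
        <⇒≤ (begin-strict
          cutCapacity afterFailure sourceSide ≤⟨ cutCapacity-monoˡ (removeEdge-≤ capacity _ _ kind) sourceSide ⟩
          cutCapacity capacity sourceSide     <⟨ light ⟩
          H                                   ≤⟨ otherCut-heavy C st x Cx≢ ⟩
          cutCapacity afterFailure C          ∎)
        where open ≤-Reasoning

module Reduction (kind : Kind) (h′ m : ℕ) where

  h : ℕ
  h = 2 + h′

  N : ℕ
  N = 2 + (h + m)

  ℓ : ℕ
  ℓ = ⌊log₂ N ⌋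

  H : ℕ
  H = N ^ 4

  -- A configuration assigns to each of the h · m left–right edges a weight in 1 … 2 ^ ℓ.
  Configuration : Set
  Configuration = Fin ((2 ^ ℓ) ^ (h * m))

  entry : Configuration → Fin (h * m) → Fin (2 ^ ℓ)
  entry = finToFun {2 ^ ℓ} {h * m}

  weight : Configuration → Fin h → Fin m → ℕ
  weight c i j = suc (toℕ (entry c (combine i j)))

  module Network (c : Configuration) = Gadget H (weight c)
  open Layout h m

  weight≤N : ∀ c i j → weight c i j ≤ N
  weight≤N c i j = ≤-trans (toℕ<n (entry c (combine i j))) (2^⌊log₂n⌋≤n z<s)

  N≤H : N ≤ H
  N≤H = m≤m*n N (N ^ 3)

  N³<H : N * (N * N) < H
  N³<H = subst (_< H) (cong (λ k → N * (N * k)) (*-identityʳ N))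
               (^-monoʳ-< N (s≤s (s≤s z≤n)) (n<1+n 3))

  weight-injective : ∀ {c c′} → (∀ i j → weight c i j ≡ weight c′ i j) → c ≡ c′
  weight-injective {c} {c′} same = finToFun-injective {h * m} {2 ^ ℓ} λ p → begin
    entry c p                              ≡⟨ cong (entry c) (combine-remQuot {h} m p) ⟨
    entry c (uncurry combine (ij p))       ≡⟨ toℕ-injective (suc-injective (uncurry same (ij p))) ⟩
    entry c′ (uncurry combine (ij p))      ≡⟨ cong (entry c′) (combine-remQuot {h} m p) ⟩
    entry c′ p                             ∎
    where
    open ≡-Reasoning
    ij : Fin (h * m) → Fin h × Fin m
    ij = remQuot {h} m

  sourceCut : Configuration → ℕ
  sourceCut c = cutCapacity (Network.capacity c) (Network.sourceSide c)

  configuration-valid : ∀ c → Valid kind H (Network.capacity c)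
  configuration-valid c =
    Network.capacity-valid c (λ i j → ≤-trans (weight≤N c i j) N≤H) (≤-trans (s≤s z≤n) N≤H) kind

  sourceCut<H : ∀ c → sourceCut c < H
  sourceCut<H c = ≤-<-trans (Network.sourceSide-cut≤ c (weight≤N c)) N³<H

  module _ (O : Oracle N) (correct : Correct kind H O) where

    encoding : Configuration → List Bool
    encoding c = encode O (Network.capacity c) zero (suc zero)

    answer : Configuration → Fin N → Fin N → ℕ
    answer c = query O (encoding c)

    answer-inner : ∀ c u v → 0 < Network.capacity c (suc (suc u)) (suc (suc v)) →
                   answer c (suc (suc u)) (suc (suc v)) ≡
                   cutCapacity (Network.afterFailure c kind u v) (Network.sourceSide c)
    answer-inner c u v edge = minCutValue-unique
      (correct (Network.capacity c) zero (suc zero) (configuration-valid c) (λ ()) _ _ edge)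
      (Network.sourceSide-minCut c kind u v (sourceCut<H c))

    answer+weight : ∀ c i j → answer c (leftVertex i) (rightVertex j) + weight c i j ≡ sourceCut c
    answer+weight c i j = begin
      answer c (leftVertex i) (rightVertex j) + weight c i j
        ≡⟨ cong₂ _+_ (answer-inner c (i ↑ˡ m) (h ↑ʳ j) (subst (0 <_) (sym capacity≡weight) z<s))
                     (sym capacity≡weight) ⟩
      cutCapacity (Network.afterFailure c kind (i ↑ˡ m) (h ↑ʳ j)) (Network.sourceSide c)
        + Network.capacity c (leftVertex i) (rightVertex j)
        ≡⟨ cutCapacity-removeEdge-across _ _ _ kind (Network.sourceSide c)
             (cong (Network.onSourceSide c) (vertex-leftVertex i))
             (cong (Network.onSourceSide c) (vertex-rightVertex j)) ⟩
      sourceCut c ∎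
      where
      open ≡-Reasoning
      capacity≡weight : Network.capacity c (leftVertex i) (rightVertex j) ≡ weight c i j
      capacity≡weight = cong₂ (Network.link c) (vertex-leftVertex i) (vertex-rightVertex j)

    answer-anchor : ∀ c → answer c (leftVertex zero) (leftVertex (suc zero)) ≡ sourceCut c
    answer-anchor c = trans
      (answer-inner c (zero ↑ˡ m) (suc zero ↑ˡ m) (subst (0 <_) (sym unit-edge) z<s))
      (cutCapacity-removeEdge-inside _ _ _ kind (Network.sourceSide c)
        (cong (Network.onSourceSide c) (vertex-leftVertex zero))
        (cong (Network.onSourceSide c) (vertex-leftVertex (suc zero))))
      where
      unit-edge : Network.capacity c (leftVertex zero) (leftVertex (suc zero)) ≡ 1
      unit-edge = cong₂ (Network.link c) (vertex-leftVertex zero) (vertex-leftVertex (suc zero))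

    encoding-injective : Injective _≡_ _≡_ encoding
    encoding-injective {c} {c′} same = weight-injective λ i j →
      +-cancelˡ-≡ (answer c (leftVertex i) (rightVertex j)) _ _ (begin
        answer c (leftVertex i) (rightVertex j) + weight c i j     ≡⟨ answer+weight c i j ⟩
        sourceCut c                                                 ≡⟨ answer-anchor c ⟨
        answer c (leftVertex zero) (leftVertex (suc zero))          ≡⟨ same-answer ⟩
        answer c′ (leftVertex zero) (leftVertex (suc zero))         ≡⟨ answer-anchor c′ ⟩
        sourceCut c′                                                ≡⟨ answer+weight c′ i j ⟨
        answer c′ (leftVertex i) (rightVertex j) + weight c′ i j    ≡⟨ cong (_+ weight c′ i j) same-answer ⟨
        answer c (leftVertex i) (rightVertex j) + weight c′ i j     ∎)
      where
      open ≡-Reasoning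
      same-answer : ∀ {x y} → answer c x y ≡ answer c′ x y
      same-answer {x} {y} = cong (λ bits → query O bits x y) same

    lowerBound : N ≤ 4 * h → h ≤ m →
                 ∃[ cap ] ∃[ s ] ∃[ t ]
                   (Valid kind H cap × s ≢ t × N * N * ℓ ≤ 16 * length (encode O cap s t))
    lowerBound N≤4h h≤m =
      let c , long = long-codeword (ℓ * (h * m)) (≤-reflexive (sym (^-*-assoc 2 ℓ (h * m))))
                                   encoding encoding-injective
      in Network.capacity c , zero , suc zero , configuration-valid c , (λ ())
       , ≤-trans (n²ℓ≤16ℓhm {N} {h} {m} ℓ N≤4h h≤m) (*-monoʳ-≤ 16 long)

LowerBoundAt : Kind → ℕ → Set
LowerBoundAt kind n =
  (O : Oracle n) → Correct kind (n ^ 4) O →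
  ∃[ cap ] ∃[ s ] ∃[ t ]
    (Valid kind (n ^ 4) cap × s ≢ t × n * n * ⌊log₂ n ⌋ ≤ 16 * length (encode O cap s t))

-- With k = n - 2 = 4 + j, ⌊ k /2⌋ reduces to 2 + ⌊ j /2⌋: there are at least two left vertices.
lowerBoundAt : ∀ kind n → 6 ≤ n → LowerBoundAt kind n
lowerBoundAt kind (suc (suc k@(suc (suc (suc (suc j)))))) (s≤s (s≤s (s≤s (s≤s (s≤s (s≤s _)))))) =
  subst (LowerBoundAt kind) N≡2+k (λ O correct → lowerBound O correct N≤4h (⌊n/2⌋≤⌈n/2⌉ k))
  where
  open Reduction kind ⌊ j /2⌋ ⌈ k /2⌉
  N≡2+k : N ≡ 2 + k
  N≡2+k = cong (2 +_) (⌊n/2⌋+⌈n/2⌉≡n k)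
  N≤4h : N ≤ 4 * h
  N≤4h = subst (_≤ 4 * h) (sym N≡2+k) (6+n≤4*⌊[4+n]/2⌋ j)

theorem10 : SpaceLowerBound undirected × SpaceLowerBound directed
theorem10 = spaceLowerBound undirected , spaceLowerBound directed
  where
  spaceLowerBound : ∀ kind → SpaceLowerBound kind
  spaceLowerBound kind = 4 , 16 , 6 , lowerBoundAt kind
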